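{- Let $r(x)=\sum_{n\ge 0}x^{2^n-1}$ and $B(x)=1-xr(x)=1-\sum_{k\ge 0}x^{2^k}$. Let $(j_n)_{n\ge 0}$ be defined by $j_0=0$, $j_{2k}=j_k$, $j_{2k+1}=(-1)^k$, and $s_n=1+\sum_{0\le k\le n}j_k$. Then for every $n\ge 0$, $|H_{n+1}(B(x))|=s_n$.
   Context: For a power series $f(x)=\sum_{i\ge 0}a_ix^i$ and $n\ge 1$, the Hankel determinant $H_n(f)$ is the determinant of the $n\times n$ matrix $(a_{i+j})_{0\le i,j\le n-1}$; $H_0(f)=1$. -}

module Defs where

open import Data.Nat as ℕ using (ℕ; zero; suc; _^_; _/_; _%_)
open import Data.Nat.Properties using (_≟_)
open import Data.Integer as ℤ using (ℤ; +_; -_; _+_; _*_; -1ℤ; 0ℤ; 1ℤ)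
open import Data.Fin as Fin using (Fin; zero; suc; toℕ; punchIn)
open import Data.List using (upTo)
open import Data.Bool.ListAction using (any)
open import Relation.Nullary.Decidable using (⌊_⌋)
open import Data.Bool using (Bool; true; false; if_then_else_)

∑ : (n : ℕ) → (Fin n → ℤ) → ℤ
∑ zero    f = 0ℤ
∑ (suc n) f = f zero + ∑ n (λ i → f (suc i))

sgn : ℕ → ℤ
sgn zero    = 1ℤ
sgn (suc k) = - sgn k

det : (n : ℕ) → (Fin n → Fin n → ℤ) → ℤ
det zero    M = 1ℤ
det (suc n) M =
  ∑ (suc n) (λ j → sgn (toℕ j) * M zero j * det n (λ a b → M (suc a) (punchIn j b)))

-- Hankel determinant H_n of a power series with coefficient sequence a
-- (H_0 = 1 by det 0 = 1)
hankel : (ℕ → ℤ) → ℕ → ℤ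
hankel a n = det n (λ i j → a (toℕ i ℕ.+ toℕ j))

-- m is a power of 2 (m = 2^k for some k ≤ m; necessarily k < m+1)
isPow2 : ℕ → Bool
isPow2 m = any (λ k → ⌊ 2 ^ k ≟ m ⌋) (upTo (suc m))

Bcoeff : ℕ → ℤ
Bcoeff zero = 1ℤ
Bcoeff (suc m) = if isPow2 (suc m) then -1ℤ else 0ℤ

-- j_n with an explicit fuel argument (fuel n+1 always suffices since
-- halving strictly decreases a positive argument).
jFuel : ℕ → ℕ → ℤ
jFuel zero     _ = 0ℤ
jFuel (suc f) zero = 0ℤ
jFuel (suc f) (suc m) with (suc m) % 2
... | zero  = jFuel f ((suc m) / 2)
... | suc _ = sgn ((suc m) / 2)

jseq : ℕ → ℤ
jseq n = jFuel (suc n) n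

sseq : ℕ → ℤ
sseq n = 1ℤ + ∑ (suc n) (λ k → jseq (toℕ k))

{-# OPTIONS --safe #-}
-- Since B(x) = B(x²) − x, the coefficients a of B satisfy a₂ₘ = aₘ and a₂ₘ₊₁ = 0 for m ≥ 1.
-- Sorting rows and columns by parity therefore turns the Hankel matrices of B(x²), shifted by
-- 2κ or 2κ + 1, into (anti-)block-diagonal matrices whose blocks are Hankel matrices of shifts
-- of B.  Writing hₖ(n) for the n × n Hankel determinant of Σᵢ aₖ₊ᵢ xⁱ, this gives recurrences
-- in ⌈n/2⌉ and ⌊n/2⌋ for h₁, …, h₄, and, after expanding the perturbation −x along the first
-- two rows, for h₀.  By strong induction h₁ and h₂ are ±1, and h₀(n + 1) = h₂(n) sₙ because
-- sₙ satisfies the matching recurrences s₂ₘ₊₁ = sₘ + [m even] and s₂ₘ₊₂ = sₘ₊₁ + [m even].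
module Submission where

open import Defs
open import Data.Nat using (ℕ; suc)
open import Data.Integer using (∣_∣; +_)
open import Relation.Binary.PropositionalEquality using (_≡_)

open import Data.Bool using (Bool; true; false; not; if_then_else_)
open import Data.Bool.Properties using (_≟_; T-≡)
open import Data.Empty using (⊥-elim)
open import Data.Fin as Fin using (Fin; toℕ; punchIn)
open import Data.Integer using (ℤ; -_; _+_; _-_; _*_; 0ℤ; 1ℤ; -1ℤ; +≤+) renaming (_≤_ to _≤ℤ_)
import Data.Integer.Properties as ℤ
open import Data.Integer.Tactic.RingSolver using (solve-∀; solve)
open import Data.List using ([]; _∷_; upTo)
open import Data.List.Membership.Propositional using (lose)
open import Data.List.Membership.Propositional.Properties using (∈-upTo⁺)
open import Data.List.Relation.Unary.Any using (satisfied)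
open import Data.List.Relation.Unary.Any.Properties using (any⁺; any⁻)
open import Data.Nat as ℕ using (zero; _≤_; _<_; z≤n; s≤s; _^_; _/_; _%_; ⌊_/2⌋; ⌈_/2⌉)
import Data.Nat.DivMod as ℕ
open import Data.Nat.Induction using (<-rec)
import Data.Nat.Properties as ℕ
open import Data.Product using (_×_; _,_; proj₁; proj₂; ∃-syntax)
open import Function using (_∘_; Equivalence)
open import Relation.Nullary using (¬_; yes; no)
open import Relation.Nullary.Decidable using (toWitness; fromWitness)
open import Relation.Binary.PropositionalEquality
  using (refl; sym; trans; cong; cong₂; subst; module ≡-Reasoning)
open import Algebra.Properties.CommutativeSemigroup ℕ.+-commutativeSemigroup using (x∙yz≈y∙xz)

-- Determinants of ℕ-indexed matrices

Matrix : Set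
Matrix = ℕ → ℕ → ℤ

infix 4 _≐_
_≐_ : Matrix → Matrix → Set
M ≐ N = ∀ i j → M i j ≡ N i j

sum : ℕ → (ℕ → ℤ) → ℤ
sum zero    f = 0ℤ
sum (suc n) f = f 0 + sum n (f ∘ suc)

punchInℕ : ℕ → ℕ → ℕ
punchInℕ zero    b       = suc b
punchInℕ (suc j) zero    = zero
punchInℕ (suc j) (suc b) = suc (punchInℕ j b)

minor : ℕ → Matrix → Matrix
minor j M a b = M (suc a) (punchInℕ j b)

-- Only the leading n × n block of M enters det′ n M.
det′ : ℕ → Matrix → ℤ
det′ zero    M = 1ℤ
det′ (suc n) M = sum (suc n) (λ j → sgn j * M 0 j * det′ n (minor j M))

sum-cong : ∀ n {f g : ℕ → ℤ} → (∀ i → i < n → f i ≡ g i) → sum n f ≡ sum n g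
sum-cong zero    eq = refl
sum-cong (suc n) eq = cong₂ _+_ (eq 0 (s≤s z≤n)) (sum-cong n (λ i i<n → eq (suc i) (s≤s i<n)))

sum-zero : ∀ n {f : ℕ → ℤ} → (∀ i → i < n → f i ≡ 0ℤ) → sum n f ≡ 0ℤ
sum-zero zero    eq = refl
sum-zero (suc n) eq = cong₂ _+_ (eq 0 (s≤s z≤n)) (sum-zero n (λ i i<n → eq (suc i) (s≤s i<n)))

sum-+ : ∀ n (f g : ℕ → ℤ) → sum n (λ i → f i + g i) ≡ sum n f + sum n g
sum-+ zero    f g = refl
sum-+ (suc n) f g = trans (cong (_+_ (f 0 + g 0)) (sum-+ n (f ∘ suc) (g ∘ suc))) (interchange (f 0) (g 0) _ _)
  where
  interchange : ∀ a b c d → a + b + (c + d) ≡ a + c + (b + d)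
  interchange = solve-∀

sum-*ʳ : ∀ n (f : ℕ → ℤ) k → sum n (λ i → f i * k) ≡ sum n f * k
sum-*ʳ zero    f k = sym (ℤ.*-zeroˡ k)
sum-*ʳ (suc n) f k = trans (cong (_+_ (f 0 * k)) (sum-*ʳ n (f ∘ suc) k)) (sym (ℤ.*-distribʳ-+ k (f 0) _))

sum-snoc : ∀ n (f : ℕ → ℤ) → sum (suc n) f ≡ sum n f + f n
sum-snoc zero    f = ℤ.+-comm (f 0) 0ℤ
sum-snoc (suc n) f = trans (cong (_+_ (f 0)) (sum-snoc n (f ∘ suc))) (sym (ℤ.+-assoc (f 0) _ _))

det′-cong : ∀ n {M N : Matrix} → M ≐ N → det′ n M ≡ det′ n N
det′-cong zero    eq = refl
det′-cong (suc n) eq = sum-cong (suc n) λ j _ →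
  cong₂ (λ x y → sgn j * x * y) (eq 0 j) (det′-cong n (λ a b → eq (suc a) (punchInℕ j b)))

∑≡sum : ∀ n (f : Fin n → ℤ) (g : ℕ → ℤ) → (∀ i → f i ≡ g (toℕ i)) → ∑ n f ≡ sum n g
∑≡sum zero    f g eq = refl
∑≡sum (suc n) f g eq = cong₂ _+_ (eq Fin.zero) (∑≡sum n (f ∘ Fin.suc) (g ∘ suc) (eq ∘ Fin.suc))

toℕ-punchIn : ∀ {n} (j : Fin (suc n)) (b : Fin n) → toℕ (punchIn j b) ≡ punchInℕ (toℕ j) (toℕ b)
toℕ-punchIn Fin.zero    b           = refl
toℕ-punchIn (Fin.suc j) Fin.zero    = refl
toℕ-punchIn (Fin.suc j) (Fin.suc b) = cong suc (toℕ-punchIn j b)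

∑-cong : ∀ n {f g : Fin n → ℤ} → (∀ i → f i ≡ g i) → ∑ n f ≡ ∑ n g
∑-cong zero    eq = refl
∑-cong (suc n) eq = cong₂ _+_ (eq Fin.zero) (∑-cong n (eq ∘ Fin.suc))

det-cong : ∀ n {M N : Fin n → Fin n → ℤ} → (∀ i j → M i j ≡ N i j) → det n M ≡ det n N
det-cong zero    eq = refl
det-cong (suc n) eq = ∑-cong (suc n) λ j →
  cong₂ (λ x y → sgn (toℕ j) * x * y) (eq Fin.zero j) (det-cong n (λ a b → eq (Fin.suc a) (punchIn j b)))

det≡det′ : ∀ n (M : Matrix) → det n (λ i j → M (toℕ i) (toℕ j)) ≡ det′ n M
det≡det′ zero    M = refl
det≡det′ (suc n) M = ∑≡sum (suc n) _ (λ j → sgn j * M 0 j * det′ n (minor j M)) λ j →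
  cong (sgn (toℕ j) * M 0 (toℕ j) *_)
    (trans (det-cong n (λ a b → cong (M (suc (toℕ a))) (toℕ-punchIn j b)))
           (det≡det′ n (minor (toℕ j) M)))

det′-row₀-+ : ∀ n {M M₁ M₂ : Matrix} → (∀ j → M 0 j ≡ M₁ 0 j + M₂ 0 j) →
              M ∘ suc ≐ M₁ ∘ suc → M ∘ suc ≐ M₂ ∘ suc →
              det′ (suc n) M ≡ det′ (suc n) M₁ + det′ (suc n) M₂
det′-row₀-+ n {M} {M₁} {M₂} row₀ rest₁ rest₂ =
  trans (sum-cong (suc n) term) (sum-+ (suc n) (expansion M₁) (expansion M₂))
  where
  expansion : Matrix → ℕ → ℤ
  expansion X j = sgn j * X 0 j * det′ n (minor j X)
  distrib : ∀ s a b d → s * (a + b) * d ≡ s * a * d + s * b * d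
  distrib = solve-∀
  term : ∀ j → j < suc n → expansion M j ≡ expansion M₁ j + expansion M₂ j
  term j _ = begin
    sgn j * M 0 j * det′ n (minor j M)                          ≡⟨ cong (λ x → sgn j * x * det′ n (minor j M)) (row₀ j) ⟩
    sgn j * (M₁ 0 j + M₂ 0 j) * det′ n (minor j M)              ≡⟨ distrib (sgn j) (M₁ 0 j) (M₂ 0 j) _ ⟩
    sgn j * M₁ 0 j * det′ n (minor j M) + sgn j * M₂ 0 j * det′ n (minor j M)
      ≡⟨ cong₂ (λ x y → sgn j * M₁ 0 j * x + sgn j * M₂ 0 j * y)
               (det′-cong n (λ a b → rest₁ a (punchInℕ j b))) (det′-cong n (λ a b → rest₂ a (punchInℕ j b))) ⟩
    expansion M₁ j + expansion M₂ j ∎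
    where open ≡-Reasoning

det′-row₁-+ : ∀ n {M M₁ M₂ : Matrix} → (∀ j → M 0 j ≡ M₁ 0 j) → (∀ j → M 0 j ≡ M₂ 0 j) →
              (∀ j → M 1 j ≡ M₁ 1 j + M₂ 1 j) →
              M ∘ suc ∘ suc ≐ M₁ ∘ suc ∘ suc → M ∘ suc ∘ suc ≐ M₂ ∘ suc ∘ suc →
              det′ (suc (suc n)) M ≡ det′ (suc (suc n)) M₁ + det′ (suc (suc n)) M₂
det′-row₁-+ n {M} {M₁} {M₂} row₀₁ row₀₂ row₁ rest₁ rest₂ =
  trans (sum-cong (suc (suc n)) term) (sum-+ (suc (suc n)) (expansion M₁) (expansion M₂))
  where
  expansion : Matrix → ℕ → ℤ
  expansion X j = sgn j * X 0 j * det′ (suc n) (minor j X)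
  distrib : ∀ s a d₁ d₂ → s * a * (d₁ + d₂) ≡ s * a * d₁ + s * a * d₂
  distrib = solve-∀
  term : ∀ j → j < suc (suc n) → expansion M j ≡ expansion M₁ j + expansion M₂ j
  term j _ = begin
    sgn j * M 0 j * det′ (suc n) (minor j M)
      ≡⟨ cong (sgn j * M 0 j *_) (det′-row₀-+ n {minor j M} {minor j M₁} {minor j M₂} (λ b → row₁ (punchInℕ j b))
                                   (λ a b → rest₁ a (punchInℕ j b)) (λ a b → rest₂ a (punchInℕ j b))) ⟩
    sgn j * M 0 j * (det′ (suc n) (minor j M₁) + det′ (suc n) (minor j M₂)) ≡⟨ distrib (sgn j) (M 0 j) _ _ ⟩
    sgn j * M 0 j * det′ (suc n) (minor j M₁) + sgn j * M 0 j * det′ (suc n) (minor j M₂)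
      ≡⟨ cong₂ (λ x y → sgn j * x * det′ (suc n) (minor j M₁) + sgn j * y * det′ (suc n) (minor j M₂))
               (row₀₁ j) (row₀₂ j) ⟩
    expansion M₁ j + expansion M₂ j ∎
    where open ≡-Reasoning

expansion-term-vanishes : ∀ n j {M : Matrix} → M 0 j ≡ 0ℤ → sgn j * M 0 j * det′ n (minor j M) ≡ 0ℤ
expansion-term-vanishes n j {M} M₀ⱼ =
  trans (cong (λ x → sgn j * x * det′ n (minor j M)) M₀ⱼ) (absorb (sgn j) (det′ n (minor j M)))
  where
  absorb : ∀ s d → s * 0ℤ * d ≡ 0ℤ
  absorb = solve-∀

det′-row₀-e₀ : ∀ n {M : Matrix} {c} → M 0 0 ≡ c → (∀ j → M 0 (suc j) ≡ 0ℤ) →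
               det′ (suc n) M ≡ c * det′ n (minor 0 M)
det′-row₀-e₀ n {M} {c} M₀₀ M₀ₛ =
  trans (cong₂ (λ x y → 1ℤ * x * det′ n (minor 0 M) + y) M₀₀
               (sum-zero n (λ j _ → expansion-term-vanishes n (suc j) {M} (M₀ₛ j))))
        (simplify (det′ n (minor 0 M)))
  where
  simplify : ∀ d → 1ℤ * c * d + 0ℤ ≡ c * d
  simplify d = solve (c ∷ d ∷ [])

det′-row₀-e₁ : ∀ n {M : Matrix} {c} → M 0 0 ≡ 0ℤ → M 0 1 ≡ c → (∀ j → M 0 (suc (suc j)) ≡ 0ℤ) →
               det′ (suc (suc n)) M ≡ - c * det′ (suc n) (minor 1 M)
det′-row₀-e₁ n {M} {c} M₀₀ M₀₁ M₀ₛₛ =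
  trans (cong₂ _+_ (expansion-term-vanishes (suc n) 0 {M} M₀₀)
          (cong₂ (λ x y → -1ℤ * x * det′ (suc n) (minor 1 M) + y) M₀₁
                 (sum-zero n (λ j _ → expansion-term-vanishes (suc n) (suc (suc j)) {M} (M₀ₛₛ j)))))
        (simplify (det′ (suc n) (minor 1 M)))
  where
  simplify : ∀ d → 0ℤ + (-1ℤ * c * d + 0ℤ) ≡ - c * d
  simplify d = solve (c ∷ d ∷ [])

rows₀₁ : (ℕ → ℤ) → (ℕ → ℤ) → Matrix → Matrix
rows₀₁ r₀ r₁ M zero          j = r₀ j
rows₀₁ r₀ r₁ M (suc zero)    j = r₁ j
rows₀₁ r₀ r₁ M (suc (suc i)) j = M (suc (suc i)) j

det′-rows₀₁-+ : ∀ n (r₀ r₀′ r₁ r₁′ : ℕ → ℤ) M → let N = suc (suc n) in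
  det′ N (rows₀₁ (λ j → r₀ j + r₀′ j) (λ j → r₁ j + r₁′ j) M)
    ≡ (det′ N (rows₀₁ r₀ r₁ M) + det′ N (rows₀₁ r₀ r₁′ M))
      + (det′ N (rows₀₁ r₀′ r₁ M) + det′ N (rows₀₁ r₀′ r₁′ M))
det′-rows₀₁-+ n r₀ r₀′ r₁ r₁′ M =
  trans (det′-row₀-+ (suc n) {rows₀₁ r₀″ r₁″ M} {rows₀₁ r₀ r₁″ M} {rows₀₁ r₀′ r₁″ M}
                     (λ j → refl) same-rows same-rows)
        (cong₂ _+_ (split-row₁ r₀) (split-row₁ r₀′))
  where
  r₀″ r₁″ : ℕ → ℤ
  r₀″ j = r₀ j + r₀′ j
  r₁″ j = r₁ j + r₁′ j
  same-rows : ∀ {s t} → rows₀₁ s r₁″ M ∘ suc ≐ rows₀₁ t r₁″ M ∘ suc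
  same-rows zero    j = refl
  same-rows (suc i) j = refl
  split-row₁ : ∀ s → det′ (suc (suc n)) (rows₀₁ s r₁″ M)
                       ≡ det′ (suc (suc n)) (rows₀₁ s r₁ M) + det′ (suc (suc n)) (rows₀₁ s r₁′ M)
  split-row₁ s = det′-row₁-+ n {rows₀₁ s r₁″ M} {rows₀₁ s r₁ M} {rows₀₁ s r₁′ M}
                   (λ j → refl) (λ j → refl) (λ j → refl) (λ i j → refl) (λ i j → refl)

negUnit : ℕ → ℕ → ℤ
negUnit zero    zero    = -1ℤ
negUnit zero    (suc j) = 0ℤ
negUnit (suc k) zero    = 0ℤ
negUnit (suc k) (suc j) = negUnit k j

-- Interleaved block matrices

Colouring : Set
Colouring = ℕ → Bool

infixr 5 _∷ᶜ_
_∷ᶜ_ : Bool → Colouring → Colouring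
(b ∷ᶜ p) zero    = b
(b ∷ᶜ p) (suc i) = p i

bit : Bool → ℕ
bit true  = 1
bit false = 0

trues : ℕ → Colouring → ℕ
trues zero    p = 0
trues (suc i) p = bit (p 0) ℕ.+ trues i (p ∘ suc)

falses : ℕ → Colouring → ℕ
falses i p = trues i (not ∘ p)

block : Bool → Bool → ℤ → ℤ → ℤ
block true  true  x y = x
block false false x y = y
block true  false x y = 0ℤ
block false true  x y = 0ℤ

-- diag(A, B) with its rows spread over the positions coloured by p and its
-- columns over those coloured by q: true positions carry A, false ones B.
interleave : Colouring → Colouring → Matrix → Matrix → Matrix
interleave p q A B i j = block (p i) (q j) (A (trues i p) (trues j q)) (B (falses i p) (falses j q))

crossingSign : Bool → ℕ → ℤ
crossingSign true  c = 1ℤ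
crossingSign false c = sgn c

-- The sign of the permutation listing the true positions of p < n before the false ones:
-- a false position is crossed by every later true one.
shuffleSign : ℕ → Colouring → ℤ
shuffleSign zero    p = 1ℤ
shuffleSign (suc n) p = crossingSign (p 0) (trues n (p ∘ suc)) * shuffleSign n (p ∘ suc)

sgn*sgn≡1 : ∀ k → sgn k * sgn k ≡ 1ℤ
sgn*sgn≡1 zero    = refl
sgn*sgn≡1 (suc k) = trans (-x*-x≡x*x (sgn k)) (sgn*sgn≡1 k)
  where
  -x*-x≡x*x : ∀ x → - x * - x ≡ x * x
  -x*-x≡x*x = solve-∀

shuffleSign² : ∀ n p → shuffleSign n p * shuffleSign n p ≡ 1ℤ
shuffleSign² zero    p = refl
shuffleSign² (suc n) p =
  trans (interchange (crossingSign (p 0) (trues n (p ∘ suc))) (shuffleSign n (p ∘ suc)))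
        (cong₂ _*_ (crossingSign² (p 0) _) (shuffleSign² n (p ∘ suc)))
  where
  interchange : ∀ a b → a * b * (a * b) ≡ (a * a) * (b * b)
  interchange = solve-∀
  crossingSign² : ∀ b c → crossingSign b c * crossingSign b c ≡ 1ℤ
  crossingSign² true  c = refl
  crossingSign² false c = sgn*sgn≡1 c

block-cong : ∀ x y {a a′ b b′} → (x ≡ true → y ≡ true → a ≡ a′) → (x ≡ false → y ≡ false → b ≡ b′) →
             block x y a b ≡ block x y a′ b′
block-cong true  true  eqA eqB = eqA refl refl
block-cong true  false eqA eqB = refl
block-cong false true  eqA eqB = refl
block-cong false false eqA eqB = eqB refl refl

block-mixed : ∀ x y {a b} → ¬ x ≡ y → block x y a b ≡ 0ℤ
block-mixed true  true  x≢y = ⊥-elim (x≢y refl)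
block-mixed true  false x≢y = refl
block-mixed false true  x≢y = refl
block-mixed false false x≢y = ⊥-elim (x≢y refl)

block-tt : ∀ {x y a b} → x ≡ true → y ≡ true → block x y a b ≡ a
block-tt refl refl = refl

block-ff : ∀ {x y a b} → x ≡ false → y ≡ false → block x y a b ≡ b
block-ff refl refl = refl

block-tf : ∀ {x y a b} → x ≡ true → y ≡ false → block x y a b ≡ 0ℤ
block-tf refl refl = refl

block-ft : ∀ {x y a b} → x ≡ false → y ≡ true → block x y a b ≡ 0ℤ
block-ft refl refl = refl

trues+falses : ∀ m p → trues m p ℕ.+ falses m p ≡ m
trues+falses zero    p = refl
trues+falses (suc m) p with p 0
... | true  = cong suc (trues+falses m (p ∘ suc))
... | false = trans (ℕ.+-suc _ _) (cong suc (trues+falses m (p ∘ suc)))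

trues≡⇒falses≡ : ∀ m p q → trues m p ≡ trues m q → falses m p ≡ falses m q
trues≡⇒falses≡ m p q eq = ℕ.+-cancelˡ-≡ (trues m p) _ _
  (trans (trues+falses m p) (trans (sym (trues+falses m q)) (cong (ℕ._+ falses m q) (sym eq))))

trues-punchIn : ∀ n j q → j ≤ n → trues (suc n) q ≡ bit (q j) ℕ.+ trues n (q ∘ punchInℕ j)
trues-punchIn n       zero    q _         = refl
trues-punchIn (suc n) (suc j) q (s≤s j≤n) =
  trans (cong (bit (q 0) ℕ.+_) (trues-punchIn n j (q ∘ suc) j≤n)) (x∙yz≈y∙xz (bit (q 0)) (bit (q (suc j))) _)

trues-punchIn-false : ∀ j b q → q j ≡ false → trues (punchInℕ j b) q ≡ trues b (q ∘ punchInℕ j)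
trues-punchIn-false zero    b       q qⱼ rewrite qⱼ = refl
trues-punchIn-false (suc j) zero    q qⱼ = refl
trues-punchIn-false (suc j) (suc b) q qⱼ = cong (bit (q 0) ℕ.+_) (trues-punchIn-false j b (q ∘ suc) qⱼ)

trues-punchIn-true : ∀ j b q → q j ≡ true → q (punchInℕ j b) ≡ true →
                     trues (punchInℕ j b) q ≡ punchInℕ (trues j q) (trues b (q ∘ punchInℕ j))
trues-punchIn-true zero    b       q qⱼ _  rewrite qⱼ = refl
trues-punchIn-true (suc j) zero    q _  q₀ rewrite q₀ = refl
trues-punchIn-true (suc j) (suc b) q qⱼ qₖ with trues-punchIn-true j b (q ∘ suc) qⱼ qₖ | q 0
... | eq | true  = cong suc eq
... | eq | false = eq

sum-over-trues : ∀ m q (H : ℕ → ℤ) → sum m (λ j → if q j then H (trues j q) else 0ℤ) ≡ sum (trues m q) H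
sum-over-trues zero    q H = refl
sum-over-trues (suc m) q H with q 0
... | true  = cong (_+_ (H 0)) (sum-over-trues m (q ∘ suc) (H ∘ suc))
... | false = trans (ℤ.+-identityˡ _) (sum-over-trues m (q ∘ suc) H)

shuffleSign-punchIn-true : ∀ n j q → q j ≡ true → j ≤ n →
  sgn j * shuffleSign n (q ∘ punchInℕ j) ≡ sgn (trues j q) * shuffleSign (suc n) q
shuffleSign-punchIn-true n zero q qⱼ _ rewrite qⱼ = cong (1ℤ *_) (sym (ℤ.*-identityˡ _))
shuffleSign-punchIn-true (suc n) (suc j) q qⱼ (s≤s j≤n)
  with shuffleSign-punchIn-true n j (q ∘ suc) qⱼ j≤n | trues-punchIn n j (q ∘ suc) j≤n
... | ih | count rewrite qⱼ | count with q 0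
... | true  = negate-both (sgn j) _ (sgn (trues j (q ∘ suc))) _ ih
  where
  negate-both : ∀ a x c y → a * x ≡ c * y → - a * (1ℤ * x) ≡ - c * (1ℤ * y)
  negate-both a x c y eq = begin
    - a * (1ℤ * x) ≡⟨ solve (a ∷ x ∷ []) ⟩
    - (a * x)      ≡⟨ cong -_ eq ⟩
    - (c * y)      ≡⟨ solve (c ∷ y ∷ []) ⟩
    - c * (1ℤ * y) ∎
    where open ≡-Reasoning
... | false = move-sign (sgn j) _ (sgn (trues j (q ∘ suc))) _ (sgn (trues n (q ∘ suc ∘ punchInℕ j))) ih
  where
  move-sign : ∀ a x c y s → a * x ≡ c * y → - a * (s * x) ≡ c * (- s * y)
  move-sign a x c y s eq = begin
    - a * (s * x)  ≡⟨ solve (a ∷ x ∷ s ∷ []) ⟩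
    - s * (a * x)  ≡⟨ cong (- s *_) eq ⟩
    - s * (c * y)  ≡⟨ solve (c ∷ y ∷ s ∷ []) ⟩
    c * (- s * y)  ∎
    where open ≡-Reasoning

shuffleSign-punchIn-false : ∀ n j q → q j ≡ false → j ≤ n →
  sgn j * shuffleSign n (q ∘ punchInℕ j) ≡ sgn (falses j q) * sgn (trues (suc n) q) * shuffleSign (suc n) q
shuffleSign-punchIn-false n zero q qⱼ _ rewrite qⱼ =
  cancel (sgn (trues n (q ∘ suc))) _ (sgn*sgn≡1 (trues n (q ∘ suc)))
  where
  cancel : ∀ s x → s * s ≡ 1ℤ → 1ℤ * x ≡ 1ℤ * s * (s * x)
  cancel s x s²≡1 = begin
    1ℤ * x            ≡⟨ cong (_* x) (sym s²≡1) ⟩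
    s * s * x         ≡⟨ solve (s ∷ x ∷ []) ⟩
    1ℤ * s * (s * x)  ∎
    where open ≡-Reasoning
shuffleSign-punchIn-false (suc n) (suc j) q qⱼ (s≤s j≤n)
  with shuffleSign-punchIn-false n j (q ∘ suc) qⱼ j≤n | trues-punchIn n j (q ∘ suc) j≤n
... | ih | count with q 0
... | true = negate-both (sgn j) _ (sgn (falses j (q ∘ suc))) (sgn (trues (suc n) (q ∘ suc))) _ ih
  where
  negate-both : ∀ a x f t y → a * x ≡ f * t * y → - a * (1ℤ * x) ≡ f * - t * (1ℤ * y)
  negate-both a x f t y eq = begin
    - a * (1ℤ * x)     ≡⟨ solve (a ∷ x ∷ []) ⟩
    - (a * x)          ≡⟨ cong -_ eq ⟩
    - (f * t * y)      ≡⟨ solve (f ∷ t ∷ y ∷ []) ⟩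
    f * - t * (1ℤ * y) ∎
    where open ≡-Reasoning
... | false =
  trans (cong (λ c → - sgn j * (sgn c * shuffleSign n (q ∘ suc ∘ punchInℕ j))) (sym count′))
        (move-sign (sgn j) _ (sgn (falses j (q ∘ suc))) (sgn (trues (suc n) (q ∘ suc))) _ ih)
  where
  count′ : trues (suc n) (q ∘ suc) ≡ trues n (q ∘ suc ∘ punchInℕ j)
  count′ = trans count (cong (λ b → bit b ℕ.+ trues n (q ∘ suc ∘ punchInℕ j)) qⱼ)
  move-sign : ∀ a x f t y → a * x ≡ f * t * y → - a * (t * x) ≡ - f * t * (t * y)
  move-sign a x f t y eq = begin
    - a * (t * x)      ≡⟨ solve (a ∷ x ∷ t ∷ []) ⟩
    - t * (a * x)      ≡⟨ cong (- t *_) eq ⟩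
    - t * (f * t * y)  ≡⟨ solve (f ∷ t ∷ y ∷ []) ⟩
    - f * t * (t * y)  ∎
    where open ≡-Reasoning

det′-unbalanced : ∀ n p q {M : Matrix} → (∀ i j → ¬ p i ≡ q j → M i j ≡ 0ℤ) →
                  ¬ trues n p ≡ trues n q → det′ n M ≡ 0ℤ
det′-unbalanced zero    p q mixed unbalanced = ⊥-elim (unbalanced refl)
det′-unbalanced (suc n) p q {M} mixed unbalanced = sum-zero (suc n) term
  where
  term : ∀ j → j < suc n → sgn j * M 0 j * det′ n (minor j M) ≡ 0ℤ
  term j (s≤s j≤n) with p 0 ≟ q j
  ... | no  p₀≢qⱼ = expansion-term-vanishes n j {M} (mixed 0 j p₀≢qⱼ)
  ... | yes p₀≡qⱼ = trans (cong (sgn j * M 0 j *_) minor-vanishes) (ℤ.*-zeroʳ (sgn j * M 0 j))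
    where
    minor-vanishes : det′ n (minor j M) ≡ 0ℤ
    minor-vanishes = det′-unbalanced n (p ∘ suc) (q ∘ punchInℕ j) (λ a b → mixed (suc a) (punchInℕ j b))
      λ eq → unbalanced (trans (cong₂ (λ b c → bit b ℕ.+ c) p₀≡qⱼ eq) (sym (trues-punchIn n j q j≤n)))

interleave-η : ∀ p q A B → interleave p q A B ≐ interleave (p 0 ∷ᶜ p ∘ suc) q A B
interleave-η p q A B zero    j = refl
interleave-η p q A B (suc i) j = refl

minor-interleave-true : ∀ j p q A B → q j ≡ true →
  minor j (interleave (true ∷ᶜ p) q A B) ≐ interleave p (q ∘ punchInℕ j) (minor (trues j q) A) B
minor-interleave-true j p q A B qⱼ a b = block-cong (p a) (q (punchInℕ j b))
  (λ _ qₖ → cong (A (suc (trues a p))) (trues-punchIn-true j b q qⱼ qₖ))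
  (λ _ _ → cong (B (falses a p)) (trues-punchIn-false j b (not ∘ q) (cong not qⱼ)))

minor-interleave-false : ∀ j p q A B → q j ≡ false →
  minor j (interleave (false ∷ᶜ p) q A B) ≐ interleave p (q ∘ punchInℕ j) A (minor (falses j q) B)
minor-interleave-false j p q A B qⱼ a b = block-cong (p a) (q (punchInℕ j b))
  (λ _ _ → cong (A (trues a p)) (trues-punchIn-false j b q qⱼ))
  (λ _ qₖ → cong (B (suc (falses a p))) (trues-punchIn-true j b (not ∘ q) (cong not qⱼ) (cong not qₖ)))

InterleaveExpansion : ℕ → Set
InterleaveExpansion n = ∀ p q A B → trues n p ≡ trues n q →
  det′ n (interleave p q A B) ≡ shuffleSign n p * shuffleSign n q * det′ (trues n q) A * det′ (falses n q) B

expansion-term-interleave-true : ∀ n → InterleaveExpansion n → ∀ p q A B j → j ≤ n → q j ≡ true →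
  suc (trues n p) ≡ trues (suc n) q → let M = interleave (true ∷ᶜ p) q A B ; r = trues j q in
  sgn j * M 0 j * det′ n (minor j M)
    ≡ sgn r * A 0 r * det′ (trues n p) (minor r A) * (shuffleSign (suc n) q * shuffleSign n p * det′ (falses (suc n) q) B)
expansion-term-interleave-true n ih p q A B j j≤n qⱼ balanced = begin
  sgn j * M 0 j * det′ n (minor j M)
    ≡⟨ cong₂ (λ x y → sgn j * x * y) (block-tt refl qⱼ)
             (trans (det′-cong n (minor-interleave-true j p q A B qⱼ)) (ih p qʲ (minor r A) B balancedʲ)) ⟩
  sgn j * A 0 r * (shuffleSign n p * shuffleSign n qʲ * det′ (trues n qʲ) (minor r A) * det′ (falses n qʲ) B)
    ≡⟨ cong₂ (λ u v → sgn j * A 0 r * (shuffleSign n p * shuffleSign n qʲ * det′ u (minor r A) * det′ v B))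
             (sym balancedʲ) falsesʲ ⟩
  sgn j * A 0 r * (shuffleSign n p * shuffleSign n qʲ * det′ (trues n p) (minor r A) * det′ (falses (suc n) q) B)
    ≡⟨ regroup (sgn j) (A 0 r) _ _ _ _ (sgn r) _ (shuffleSign-punchIn-true n j q qⱼ j≤n) ⟩
  sgn r * A 0 r * det′ (trues n p) (minor r A) * (shuffleSign (suc n) q * shuffleSign n p * det′ (falses (suc n) q) B) ∎
  where
  open ≡-Reasoning
  M = interleave (true ∷ᶜ p) q A B
  r = trues j q
  qʲ = q ∘ punchInℕ j
  balancedʲ : trues n p ≡ trues n qʲ
  balancedʲ = ℕ.suc-injective (trans balanced (trans (trues-punchIn n j q j≤n) (cong (λ b → bit b ℕ.+ trues n qʲ) qⱼ)))
  falsesʲ : falses n qʲ ≡ falses (suc n) q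
  falsesʲ = sym (trans (trues-punchIn n j (not ∘ q) j≤n) (cong (λ b → bit (not b) ℕ.+ falses n qʲ) qⱼ))
  regroup : ∀ s a t u x y v w → s * u ≡ v * w → s * a * (t * u * x * y) ≡ v * a * x * (w * t * y)
  regroup s a t u x y v w eq = begin
    s * a * (t * u * x * y) ≡⟨ solve (s ∷ a ∷ t ∷ u ∷ x ∷ y ∷ []) ⟩
    a * t * x * y * (s * u) ≡⟨ cong (a * t * x * y *_) eq ⟩
    a * t * x * y * (v * w) ≡⟨ solve (a ∷ t ∷ x ∷ y ∷ v ∷ w ∷ []) ⟩
    v * a * x * (w * t * y) ∎

det′-interleave-true : ∀ n → InterleaveExpansion n → ∀ p q A B → suc (trues n p) ≡ trues (suc n) q →
  det′ (suc n) (interleave (true ∷ᶜ p) q A B)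
    ≡ shuffleSign (suc n) (true ∷ᶜ p) * shuffleSign (suc n) q * det′ (trues (suc n) q) A * det′ (falses (suc n) q) B
det′-interleave-true n ih p q A B balanced = begin
  det′ (suc n) M                                          ≡⟨ sum-cong (suc n) column ⟩
  sum (suc n) (λ j → if q j then H (trues j q) else 0ℤ)   ≡⟨ sum-over-trues (suc n) q H ⟩
  sum (trues (suc n) q) H                                 ≡⟨ cong (λ m → sum m H) (sym balanced) ⟩
  sum (suc c) H                                           ≡⟨ sum-*ʳ (suc c) G K ⟩
  det′ (suc c) A * K                                      ≡⟨ rearrange (det′ (suc c) A) σq σp d ⟩
  1ℤ * σp * σq * det′ (suc c) A * d                       ≡⟨ cong (λ m → 1ℤ * σp * σq * det′ m A * d) balanced ⟩
  1ℤ * σp * σq * det′ (trues (suc n) q) A * d             ∎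
  where
  open ≡-Reasoning
  M = interleave (true ∷ᶜ p) q A B
  c = trues n p
  σp = shuffleSign n p
  σq = shuffleSign (suc n) q
  d = det′ (falses (suc n) q) B
  G : ℕ → ℤ
  G r = sgn r * A 0 r * det′ c (minor r A)
  K = σq * σp * d
  H : ℕ → ℤ
  H r = G r * K
  rearrange : ∀ a s t e → a * (s * t * e) ≡ 1ℤ * t * s * a * e
  rearrange = solve-∀
  column : ∀ j → j < suc n → sgn j * M 0 j * det′ n (minor j M) ≡ (if q j then H (trues j q) else 0ℤ)
  column j (s≤s j≤n) = by-colour (q j) refl
    where
    by-colour : ∀ b → q j ≡ b → sgn j * M 0 j * det′ n (minor j M) ≡ (if q j then H (trues j q) else 0ℤ)
    by-colour false qⱼ = trans (expansion-term-vanishes n j {M} (block-tf refl qⱼ))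
                               (cong (λ b → if b then H (trues j q) else 0ℤ) (sym qⱼ))
    by-colour true  qⱼ = trans (expansion-term-interleave-true n ih p q A B j j≤n qⱼ balanced)
                               (cong (λ b → if b then H (trues j q) else 0ℤ) (sym qⱼ))

expansion-term-interleave-false : ∀ n → InterleaveExpansion n → ∀ p q A B j → j ≤ n → q j ≡ false →
  trues n p ≡ trues (suc n) q → let M = interleave (false ∷ᶜ p) q A B ; r = falses j q ; c = trues n p in
  sgn j * M 0 j * det′ n (minor j M)
    ≡ sgn r * B 0 r * det′ (falses n p) (minor r B) * (sgn c * shuffleSign (suc n) q * shuffleSign n p * det′ c A)
expansion-term-interleave-false n ih p q A B j j≤n qⱼ balanced = begin
  sgn j * M 0 j * det′ n (minor j M)
    ≡⟨ cong₂ (λ x y → sgn j * x * y) (block-ff refl qⱼ)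
             (trans (det′-cong n (minor-interleave-false j p q A B qⱼ)) (ih p qʲ A (minor r B) balancedʲ)) ⟩
  sgn j * B 0 r * (shuffleSign n p * shuffleSign n qʲ * det′ (trues n qʲ) A * det′ (falses n qʲ) (minor r B))
    ≡⟨ cong₂ (λ u v → sgn j * B 0 r * (shuffleSign n p * shuffleSign n qʲ * det′ u A * det′ v (minor r B)))
             (sym balancedʲ) falsesʲ ⟩
  sgn j * B 0 r * (shuffleSign n p * shuffleSign n qʲ * det′ c A * det′ (falses n p) (minor r B))
    ≡⟨ regroup (sgn j) (B 0 r) _ _ (det′ c A) _ (sgn r) (sgn c) _ signs ⟩
  sgn r * B 0 r * det′ (falses n p) (minor r B) * (sgn c * shuffleSign (suc n) q * shuffleSign n p * det′ c A) ∎
  where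
  open ≡-Reasoning
  M = interleave (false ∷ᶜ p) q A B
  r = falses j q
  c = trues n p
  qʲ = q ∘ punchInℕ j
  balancedʲ : c ≡ trues n qʲ
  balancedʲ = trans balanced (trans (trues-punchIn n j q j≤n) (cong (λ b → bit b ℕ.+ trues n qʲ) qⱼ))
  falsesʲ : falses n qʲ ≡ falses n p
  falsesʲ = ℕ.suc-injective (trans (sym (trans (trues-punchIn n j (not ∘ q) j≤n)
              (cong (λ b → bit (not b) ℕ.+ falses n qʲ) qⱼ))) (sym (trues≡⇒falses≡ (suc n) (false ∷ᶜ p) q balanced)))
  signs : sgn j * shuffleSign n qʲ ≡ sgn r * sgn c * shuffleSign (suc n) q
  signs = trans (shuffleSign-punchIn-false n j q qⱼ j≤n) (cong (λ u → sgn r * sgn u * shuffleSign (suc n) q) (sym balanced))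
  regroup : ∀ s b t u x y v w z → s * u ≡ v * w * z → s * b * (t * u * x * y) ≡ v * b * y * (w * z * t * x)
  regroup s b t u x y v w z eq = begin
    s * b * (t * u * x * y)     ≡⟨ solve (s ∷ b ∷ t ∷ u ∷ x ∷ y ∷ []) ⟩
    b * t * x * y * (s * u)     ≡⟨ cong (b * t * x * y *_) eq ⟩
    b * t * x * y * (v * w * z) ≡⟨ solve (b ∷ t ∷ x ∷ y ∷ v ∷ w ∷ z ∷ []) ⟩
    v * b * y * (w * z * t * x) ∎

det′-interleave-false : ∀ n → InterleaveExpansion n → ∀ p q A B → trues n p ≡ trues (suc n) q →
  det′ (suc n) (interleave (false ∷ᶜ p) q A B)
    ≡ shuffleSign (suc n) (false ∷ᶜ p) * shuffleSign (suc n) q * det′ (trues (suc n) q) A * det′ (falses (suc n) q) B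
det′-interleave-false n ih p q A B balanced = begin
  det′ (suc n) M                                                ≡⟨ sum-cong (suc n) column ⟩
  sum (suc n) (λ j → if not (q j) then H (falses j q) else 0ℤ)  ≡⟨ sum-over-trues (suc n) (not ∘ q) H ⟩
  sum (falses (suc n) q) H                                      ≡⟨ cong (λ m → sum m H) (sym falsesBalanced) ⟩
  sum (suc f) H                                                 ≡⟨ sum-*ʳ (suc f) G K ⟩
  det′ (suc f) B * K                                            ≡⟨ rearrange (det′ (suc f) B) (sgn c) σq σp (det′ c A) ⟩
  sgn c * σp * σq * det′ c A * det′ (suc f) B
    ≡⟨ cong₂ (λ u v → sgn c * σp * σq * det′ u A * det′ v B) balanced falsesBalanced ⟩
  sgn c * σp * σq * det′ (trues (suc n) q) A * det′ (falses (suc n) q) B ∎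
  where
  open ≡-Reasoning
  M = interleave (false ∷ᶜ p) q A B
  c = trues n p
  f = falses n p
  σp = shuffleSign n p
  σq = shuffleSign (suc n) q
  falsesBalanced : suc f ≡ falses (suc n) q
  falsesBalanced = trues≡⇒falses≡ (suc n) (false ∷ᶜ p) q balanced
  G : ℕ → ℤ
  G r = sgn r * B 0 r * det′ f (minor r B)
  K = sgn c * σq * σp * det′ c A
  H : ℕ → ℤ
  H r = G r * K
  rearrange : ∀ b s t u a → b * (s * t * u * a) ≡ s * u * t * a * b
  rearrange = solve-∀
  column : ∀ j → j < suc n → sgn j * M 0 j * det′ n (minor j M) ≡ (if not (q j) then H (falses j q) else 0ℤ)
  column j (s≤s j≤n) = by-colour (q j) refl
    where
    by-colour : ∀ b → q j ≡ b → sgn j * M 0 j * det′ n (minor j M) ≡ (if not (q j) then H (falses j q) else 0ℤ)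
    by-colour true  qⱼ = trans (expansion-term-vanishes n j {M} (block-ft refl qⱼ))
                               (cong (λ b → if not b then H (falses j q) else 0ℤ) (sym qⱼ))
    by-colour false qⱼ = trans (expansion-term-interleave-false n ih p q A B j j≤n qⱼ balanced)
                               (cong (λ b → if not b then H (falses j q) else 0ℤ) (sym qⱼ))

det′-interleave : ∀ n → InterleaveExpansion n
det′-interleave zero    p q A B balanced = refl
det′-interleave (suc n) p q A B balanced =
  trans (det′-cong (suc n) (interleave-η p q A B)) (by-colour (p 0) (p ∘ suc) balanced)
  where
  by-colour : ∀ b p′ → trues (suc n) (b ∷ᶜ p′) ≡ trues (suc n) q →
              det′ (suc n) (interleave (b ∷ᶜ p′) q A B)
                ≡ shuffleSign (suc n) (b ∷ᶜ p′) * shuffleSign (suc n) q * det′ (trues (suc n) q) A * det′ (falses (suc n) q) B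
  by-colour true  p′ = det′-interleave-true  n (det′-interleave n) p′ q A B
  by-colour false p′ = det′-interleave-false n (det′-interleave n) p′ q A B

double : ℕ → ℕ
double zero    = zero
double (suc m) = suc (suc (double m))

data EvenOdd : ℕ → Set where
  even : ∀ m → EvenOdd (double m)
  odd  : ∀ m → EvenOdd (suc (double m))

evenOdd : ∀ n → EvenOdd n
evenOdd zero          = even 0
evenOdd (suc zero)    = odd 0
evenOdd (suc (suc n)) with evenOdd n
... | even m = even (suc m)
... | odd  m = odd (suc m)

⌊double/2⌋ : ∀ m → ⌊ double m /2⌋ ≡ m
⌊double/2⌋ zero    = refl
⌊double/2⌋ (suc m) = cong suc (⌊double/2⌋ m)

⌊1+double/2⌋ : ∀ m → ⌊ suc (double m) /2⌋ ≡ m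
⌊1+double/2⌋ zero    = refl
⌊1+double/2⌋ (suc m) = cong suc (⌊1+double/2⌋ m)

⌈double/2⌉ : ∀ m → ⌈ double m /2⌉ ≡ m
⌈double/2⌉ = ⌊1+double/2⌋

m≤double : ∀ m → m ≤ double m
m≤double zero    = z≤n
m≤double (suc m) = s≤s (ℕ.m≤n⇒m≤1+n (m≤double m))

evens : Colouring
evens zero          = true
evens (suc zero)    = false
evens (suc (suc n)) = evens n

odds : Colouring
odds = evens ∘ suc

evens-double : ∀ m → evens (double m) ≡ true
evens-double zero    = refl
evens-double (suc m) = evens-double m

evens-1+double : ∀ m → evens (suc (double m)) ≡ false
evens-1+double zero    = refl
evens-1+double (suc m) = evens-1+double m

trues-evens : ∀ n → trues n evens ≡ ⌈ n /2⌉
trues-odds  : ∀ n → trues n odds ≡ ⌊ n /2⌋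
trues-evens zero    = refl
trues-evens (suc n) = cong suc (trues-odds n)
trues-odds  zero    = refl
trues-odds  (suc n) = trues-evens n

falses-evens : ∀ n → falses n evens ≡ ⌊ n /2⌋
falses-odds  : ∀ n → falses n odds ≡ ⌈ n /2⌉
falses-evens zero    = refl
falses-evens (suc n) = falses-odds n
falses-odds  zero    = refl
falses-odds  (suc n) = cong suc (falses-evens n)

shuffleSign-evens*odds : ∀ m → shuffleSign (double m) evens * shuffleSign (double m) odds ≡ sgn m
shuffleSign-evens*odds zero    = refl
shuffleSign-evens*odds (suc m) = begin
  1ℤ * (sgn (trues (double m) evens) * σₑ) * (sgn (trues (suc (double m)) evens) * (1ℤ * σₒ))
    ≡⟨ cong₂ (λ u v → 1ℤ * (sgn u * σₑ) * (sgn v * (1ℤ * σₒ)))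
             (trans (trues-evens (double m)) (⌈double/2⌉ m)) (trans (trues-evens (suc (double m))) (cong suc (⌊double/2⌋ m))) ⟩
  1ℤ * (sgn m * σₑ) * (- sgn m * (1ℤ * σₒ)) ≡⟨ regroup (sgn m) σₑ σₒ ⟩
  - (sgn m * sgn m) * (σₑ * σₒ)             ≡⟨ cong₂ (λ u v → - u * v) (sgn*sgn≡1 m) (shuffleSign-evens*odds m) ⟩
  - 1ℤ * sgn m                              ≡⟨ ℤ.-1*i≡-i (sgn m) ⟩
  - sgn m                                   ∎
  where
  open ≡-Reasoning
  σₑ = shuffleSign (double m) evens
  σₒ = shuffleSign (double m) odds
  regroup : ∀ s e o → 1ℤ * (s * e) * (- s * (1ℤ * o)) ≡ - (s * s) * (e * o)
  regroup = solve-∀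

double-+ : ∀ m n → double (m ℕ.+ n) ≡ double m ℕ.+ double n
double-+ zero    n = refl
double-+ (suc m) n = cong (suc ∘ suc) (double-+ m n)

evenBit : ℕ → ℤ
evenBit m = + bit (evens m)

evenBit+sgn : ∀ m → evenBit m + sgn (suc m) ≡ evenBit (suc m)
evenBit+sgn zero          = refl
evenBit+sgn (suc zero)    = refl
evenBit+sgn (suc (suc m)) = trans (cong (_+_ (evenBit m)) (ℤ.neg-involutive (sgn (suc m)))) (evenBit+sgn m)

-- Hankel determinants of sequences with the recurrences of B

IsSign : ℤ → Set
IsSign x = x * x ≡ 1ℤ

IsSign-* : ∀ x y → IsSign x → IsSign y → IsSign (x * y)
IsSign-* x y x²≡1 y²≡1 = trans (interchange x y) (cong₂ _*_ x²≡1 y²≡1)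
  where
  interchange : ∀ x y → (x * y) * (x * y) ≡ (x * x) * (y * y)
  interchange = solve-∀

IsSign-*x*x : ∀ s x → IsSign s → IsSign x → IsSign (s * x * x)
IsSign-*x*x s x s²≡1 x²≡1 = IsSign-* (s * x) x (IsSign-* s x s²≡1 x²≡1) x²≡1

∣sign*x∣≡∣x∣ : ∀ u x → IsSign u → ∣ u * x ∣ ≡ ∣ x ∣
∣sign*x∣≡∣x∣ u x u²≡1 = begin
  ∣ u * x ∣       ≡⟨ ℤ.abs-* u x ⟩
  ∣ u ∣ ℕ.* ∣ x ∣ ≡⟨ cong (ℕ._* ∣ x ∣) ∣u∣≡1 ⟩
  1 ℕ.* ∣ x ∣     ≡⟨ ℕ.*-identityˡ ∣ x ∣ ⟩
  ∣ x ∣           ∎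
  where
  open ≡-Reasoning
  ∣u∣≡1 : ∣ u ∣ ≡ 1
  ∣u∣≡1 = ℕ.m*n≡1⇒m≡1 ∣ u ∣ ∣ u ∣ (trans (sym (ℤ.abs-* u u)) (cong ∣_∣ u²≡1))

module HankelRecurrences (a : ℕ → ℤ) (a₀ : a 0 ≡ 1ℤ) (a₁ : a 1 ≡ -1ℤ)
  (a-double : ∀ m → a (double (suc m)) ≡ a (suc m)) (a-1+double : ∀ m → a (suc (double (suc m))) ≡ 0ℤ) where

  -- If a is the coefficient sequence of B then b is that of B(x²).
  b : ℕ → ℤ
  b zero          = a 0
  b (suc zero)    = 0ℤ
  b (suc (suc m)) = a (suc (suc m))

  b-double : ∀ m → b (double m) ≡ a m
  b-double zero    = refl
  b-double (suc m) = a-double m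

  b-1+double : ∀ m → b (suc (double m)) ≡ 0ℤ
  b-1+double zero    = refl
  b-1+double (suc m) = a-1+double m

  H : ℕ → Matrix
  H k i j = a (k ℕ.+ (i ℕ.+ j))

  Hᵇ : ℕ → Matrix
  Hᵇ k i j = b (k ℕ.+ (i ℕ.+ j))

  h : ℕ → ℕ → ℤ
  h k n = det′ n (H k)

  private
    double-+₃ : ∀ κ x y → double κ ℕ.+ (double x ℕ.+ double y) ≡ double (κ ℕ.+ (x ℕ.+ y))
    double-+₃ κ x y = sym (trans (double-+ κ (x ℕ.+ y)) (cong (double κ ℕ.+_) (double-+ x y)))

    double-+₃-odd : ∀ κ x y → double κ ℕ.+ (double x ℕ.+ suc (double y)) ≡ suc (double (κ ℕ.+ (x ℕ.+ y)))
    double-+₃-odd κ x y =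
      trans (cong (double κ ℕ.+_) (ℕ.+-suc (double x) (double y))) (trans (ℕ.+-suc (double κ) _) (cong suc (double-+₃ κ x y)))

    double-+₃-suc : ∀ κ x y → double κ ℕ.+ (suc (double x) ℕ.+ suc (double y)) ≡ double (suc (κ ℕ.+ (x ℕ.+ y)))
    double-+₃-suc κ x y = trans (ℕ.+-suc (double κ) _) (cong suc (double-+₃-odd κ x y))

  Hᵇ-double : ∀ κ → Hᵇ (double κ) ≐ interleave evens evens (H κ) (H (suc κ))
  Hᵇ-double κ i j with evenOdd i | evenOdd j
  ... | even x | even y = trans (cong b (double-+₃ κ x y)) (trans (b-double _) (sym
          (trans (block-tt (evens-double x) (evens-double y))
                 (cong₂ (H κ) (trans (trues-evens (double x)) (⌈double/2⌉ x))
                              (trans (trues-evens (double y)) (⌈double/2⌉ y))))))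
  ... | odd x  | odd y  = trans (cong b (double-+₃-suc κ x y)) (trans (b-double _) (sym
          (trans (block-ff (evens-1+double x) (evens-1+double y))
                 (cong₂ (H (suc κ)) (trans (falses-evens (suc (double x))) (⌊1+double/2⌋ x))
                                    (trans (falses-evens (suc (double y))) (⌊1+double/2⌋ y))))))
  ... | even x | odd y  = trans (cong b (double-+₃-odd κ x y)) (trans (b-1+double (κ ℕ.+ (x ℕ.+ y)))
          (sym (block-tf (evens-double x) (evens-1+double y))))
  ... | odd x  | even y = trans (cong b (trans (ℕ.+-suc (double κ) _) (cong suc (double-+₃ κ x y))))
          (trans (b-1+double (κ ℕ.+ (x ℕ.+ y))) (sym (block-ft (evens-1+double x) (evens-double y))))

  Hᵇ-1+double : ∀ κ → Hᵇ (suc (double κ)) ≐ interleave evens odds (H (suc κ)) (H (suc κ))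
  Hᵇ-1+double κ i j with evenOdd i | evenOdd j
  ... | even x | even y = trans (cong (b ∘ suc) (double-+₃ κ x y)) (trans (b-1+double (κ ℕ.+ (x ℕ.+ y)))
          (sym (block-tf (evens-double x) (evens-1+double y))))
  ... | odd x  | odd y  = trans (cong (b ∘ suc) (double-+₃-suc κ x y)) (trans (b-1+double (suc (κ ℕ.+ (x ℕ.+ y))))
          (sym (block-ft (evens-1+double x) (evens-double (suc y)))))
  ... | even x | odd y  = trans (cong (b ∘ suc) (double-+₃-odd κ x y)) (trans (b-double (suc (κ ℕ.+ (x ℕ.+ y)))) (sym
          (trans (block-tt (evens-double x) (evens-double (suc y)))
                 (cong₂ (H (suc κ)) (trans (trues-evens (double x)) (⌈double/2⌉ x))
                                    (trans (trues-odds (suc (double y))) (⌊1+double/2⌋ y))))))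
  ... | odd x  | even y = trans (cong (b ∘ suc) (trans (ℕ.+-suc (double κ) _) (cong suc (double-+₃ κ x y))))
          (trans (b-double (suc (κ ℕ.+ (x ℕ.+ y)))) (sym
          (trans (block-ff (evens-1+double x) (evens-1+double y))
                 (cong₂ (H (suc κ)) (trans (falses-evens (suc (double x))) (⌊1+double/2⌋ x))
                                    (trans (falses-odds (double y)) (⌈double/2⌉ y))))))

  det-Hᵇ-double : ∀ n κ → det′ n (Hᵇ (double κ)) ≡ h κ ⌈ n /2⌉ * h (suc κ) ⌊ n /2⌋
  det-Hᵇ-double n κ = begin
    det′ n (Hᵇ (double κ))
      ≡⟨ det′-cong n (Hᵇ-double κ) ⟩
    det′ n (interleave evens evens (H κ) (H (suc κ)))
      ≡⟨ det′-interleave n evens evens (H κ) (H (suc κ)) refl ⟩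
    σ * σ * h κ (trues n evens) * h (suc κ) (falses n evens)
      ≡⟨ cong₂ (λ u v → σ * σ * h κ u * h (suc κ) v) (trues-evens n) (falses-evens n) ⟩
    σ * σ * h κ ⌈ n /2⌉ * h (suc κ) ⌊ n /2⌋
      ≡⟨ cong (λ s → s * h κ ⌈ n /2⌉ * h (suc κ) ⌊ n /2⌋) (shuffleSign² n evens) ⟩
    1ℤ * h κ ⌈ n /2⌉ * h (suc κ) ⌊ n /2⌋
      ≡⟨ cong (_* h (suc κ) ⌊ n /2⌋) (ℤ.*-identityˡ (h κ ⌈ n /2⌉)) ⟩
    h κ ⌈ n /2⌉ * h (suc κ) ⌊ n /2⌋ ∎
    where
    open ≡-Reasoning
    σ = shuffleSign n evens

  det-Hᵇ-1+double-even : ∀ m κ → det′ (double m) (Hᵇ (suc (double κ))) ≡ sgn m * h (suc κ) m * h (suc κ) m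
  det-Hᵇ-1+double-even m κ = begin
    det′ (double m) (Hᵇ (suc (double κ)))
      ≡⟨ det′-cong (double m) (Hᵇ-1+double κ) ⟩
    det′ (double m) (interleave evens odds (H (suc κ)) (H (suc κ)))
      ≡⟨ det′-interleave (double m) evens odds (H (suc κ)) (H (suc κ)) (trans half (sym half′)) ⟩
    shuffleSign (double m) evens * shuffleSign (double m) odds * h (suc κ) (trues (double m) odds) * h (suc κ) (falses (double m) odds)
      ≡⟨ cong₂ (λ u v → u * h (suc κ) (trues (double m) odds) * v) (shuffleSign-evens*odds m) (cong (h (suc κ)) half″) ⟩
    sgn m * h (suc κ) (trues (double m) odds) * h (suc κ) m
      ≡⟨ cong (λ u → sgn m * h (suc κ) u * h (suc κ) m) half′ ⟩
    sgn m * h (suc κ) m * h (suc κ) m ∎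
    where
    open ≡-Reasoning
    half : trues (double m) evens ≡ m
    half = trans (trues-evens (double m)) (⌈double/2⌉ m)
    half′ : trues (double m) odds ≡ m
    half′ = trans (trues-odds (double m)) (⌊double/2⌋ m)
    half″ : falses (double m) odds ≡ m
    half″ = trans (falses-odds (double m)) (⌈double/2⌉ m)

  det-Hᵇ-1+double-odd : ∀ m κ → det′ (suc (double m)) (Hᵇ (suc (double κ))) ≡ 0ℤ
  det-Hᵇ-1+double-odd m κ =
    det′-unbalanced (suc (double m)) evens odds (λ i j p≢q → trans (Hᵇ-1+double κ i j) (block-mixed (evens i) (odds j) p≢q))
      λ eq → ℕ.1+n≢n (trans (sym (more-evens)) (trans eq (trans (trues-odds (suc (double m))) (⌊1+double/2⌋ m))))
    where
    more-evens : trues (suc (double m)) evens ≡ suc m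
    more-evens = trans (trues-evens (suc (double m))) (cong suc (⌊double/2⌋ m))

  h2-recurrence : ∀ n → h 2 n ≡ h 1 ⌈ n /2⌉ * h 2 ⌊ n /2⌋
  h2-recurrence n = det-Hᵇ-double n 1

  h4-recurrence : ∀ n → h 4 n ≡ h 2 ⌈ n /2⌉ * h 3 ⌊ n /2⌋
  h4-recurrence n = det-Hᵇ-double n 2

  h3-double : ∀ m → h 3 (double m) ≡ sgn m * h 2 m * h 2 m
  h3-double m = det-Hᵇ-1+double-even m 1

  h3-1+double : ∀ m → h 3 (suc (double m)) ≡ 0ℤ
  h3-1+double m = det-Hᵇ-1+double-odd m 1

  h1-recurrence : ∀ n → h 1 (suc n) ≡ det′ (suc n) (Hᵇ 1) - h 3 n
  h1-recurrence n = begin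
    h 1 (suc n)                           ≡⟨ det′-row₀-+ n {H 1} {Hᵇ 1} {E} row₀ (λ i j → refl) rest ⟩
    det′ (suc n) (Hᵇ 1) + det′ (suc n) E  ≡⟨ cong (_+_ (det′ (suc n) (Hᵇ 1))) expand-E ⟩
    det′ (suc n) (Hᵇ 1) - h 3 n           ∎
    where
    open ≡-Reasoning
    E : Matrix
    E = rows₀₁ (negUnit 0) (H 1 1) (H 1)
    row₀ : ∀ j → a (suc j) ≡ b (suc j) + negUnit 0 j
    row₀ zero    = a₁
    row₀ (suc j) = sym (ℤ.+-identityʳ _)
    rest : H 1 ∘ suc ≐ E ∘ suc
    rest zero    j = refl
    rest (suc i) j = refl
    shift : minor 0 E ≐ H 3
    shift zero    y = cong a (cong (suc ∘ suc) (ℕ.+-suc 0 y))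
    shift (suc x) y = cong a (cong (suc ∘ suc) (ℕ.+-suc (suc x) y))
    expand-E : det′ (suc n) E ≡ - h 3 n
    expand-E = trans (det′-row₀-e₀ n {E} refl (λ j → refl))
                     (trans (cong (-1ℤ *_) (det′-cong n shift)) (ℤ.-1*i≡-i (h 3 n)))

  h1-double : ∀ m → h 1 (double (suc m)) ≡ sgn (suc m) * h 1 (suc m) * h 1 (suc m)
  h1-double m = begin
    h 1 (double (suc m))                                              ≡⟨ h1-recurrence (suc (double m)) ⟩
    det′ (double (suc m)) (Hᵇ 1) - h 3 (suc (double m))
      ≡⟨ cong₂ _-_ (det-Hᵇ-1+double-even (suc m) 0) (h3-1+double m) ⟩
    sgn (suc m) * h 1 (suc m) * h 1 (suc m) - 0ℤ                      ≡⟨ ℤ.+-identityʳ _ ⟩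
    sgn (suc m) * h 1 (suc m) * h 1 (suc m)                           ∎
    where open ≡-Reasoning

  h1-1+double : ∀ m → h 1 (suc (double m)) ≡ - sgn m * h 2 m * h 2 m
  h1-1+double m = begin
    h 1 (suc (double m))                                   ≡⟨ h1-recurrence (double m) ⟩
    det′ (suc (double m)) (Hᵇ 1) - h 3 (double m)          ≡⟨ cong₂ _-_ (det-Hᵇ-1+double-odd m 0) (h3-double m) ⟩
    0ℤ - sgn m * h 2 m * h 2 m                              ≡⟨ rearrange (sgn m) (h 2 m) ⟩
    - sgn m * h 2 m * h 2 m                                 ∎
    where
    open ≡-Reasoning
    rearrange : ∀ s x → 0ℤ - s * x * x ≡ - s * x * x
    rearrange = solve-∀

  private
    Hᵇ-rows≥2 : ∀ i j → ¬ evens i ≡ evens j → Hᵇ 0 (suc (suc i)) j ≡ 0ℤ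
    Hᵇ-rows≥2 i j ne = trans (Hᵇ-double 0 (suc (suc i)) j) (block-mixed (evens i) (evens j) ne)

  -- Rows 0 and 1, like the even rows below them, are supported on the even columns.
  det-even-rows₀₁ : ∀ n → det′ (suc (suc n)) (rows₀₁ b (negUnit 0) (Hᵇ 0)) ≡ 0ℤ
  det-even-rows₀₁ n = det′-unbalanced (suc (suc n)) (true ∷ᶜ true ∷ᶜ evens) evens mixed
                        (ℕ.1+n≢n ∘ ℕ.suc-injective)
    where
    mixed : ∀ i j → ¬ (true ∷ᶜ true ∷ᶜ evens) i ≡ evens j → rows₀₁ b (negUnit 0) (Hᵇ 0) i j ≡ 0ℤ
    mixed zero j ne with evenOdd j
    ... | even y = ⊥-elim (ne (sym (evens-double y)))
    ... | odd  y = b-1+double y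
    mixed (suc zero)    zero    ne = ⊥-elim (ne refl)
    mixed (suc zero)    (suc j) ne = refl
    mixed (suc (suc i)) j       ne = Hᵇ-rows≥2 i j ne

  -- Rows 0 and 1, like the odd rows below them, are supported on the odd columns.
  det-odd-rows₀₁ : ∀ n → det′ (suc (suc n)) (rows₀₁ (negUnit 1) (b ∘ suc) (Hᵇ 0)) ≡ 0ℤ
  det-odd-rows₀₁ n = det′-unbalanced (suc (suc n)) (false ∷ᶜ false ∷ᶜ evens) evens mixed (ℕ.1+n≢n ∘ sym)
    where
    mixed : ∀ i j → ¬ (false ∷ᶜ false ∷ᶜ evens) i ≡ evens j → rows₀₁ (negUnit 1) (b ∘ suc) (Hᵇ 0) i j ≡ 0ℤ
    mixed zero          zero          ne = refl
    mixed zero          (suc zero)    ne = ⊥-elim (ne refl)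
    mixed zero          (suc (suc j)) ne = refl
    mixed (suc zero)    j             ne with evenOdd j
    ... | even y = b-1+double y
    ... | odd  y = ⊥-elim (ne (sym (evens-1+double y)))
    mixed (suc (suc i)) j             ne = Hᵇ-rows≥2 i j ne

  det-negUnit-rows₀₁ : ∀ n → det′ (suc (suc n)) (rows₀₁ (negUnit 1) (negUnit 0) (Hᵇ 0)) ≡ - h 4 n
  det-negUnit-rows₀₁ n =
    trans (det′-row₀-e₁ n {M} refl refl (λ j → refl))
          (trans (cong (- -1ℤ *_) (det′-row₀-e₀ n {minor 1 M} refl (λ j → refl)))
                 (trans (cong (λ d → - -1ℤ * (-1ℤ * d)) (det′-cong n shift)) (simplify (h 4 n))))
    where
    M = rows₀₁ (negUnit 1) (negUnit 0) (Hᵇ 0)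
    shift : minor 0 (minor 1 M) ≐ H 4
    shift x y = cong (a ∘ suc ∘ suc) (trans (ℕ.+-suc x (suc y)) (cong suc (ℕ.+-suc x y)))
    simplify : ∀ d → - -1ℤ * (-1ℤ * d) ≡ - d
    simplify = solve-∀

  h0-recurrence : ∀ n → h 0 (suc (suc n)) ≡ h 0 ⌈ suc (suc n) /2⌉ * h 1 ⌊ suc (suc n) /2⌋ - h 4 n
  h0-recurrence n = begin
    h 0 N                                                    ≡⟨ det′-cong N split ⟩
    det′ N (rows₀₁ (λ j → b j + negUnit 1 j) (λ j → b (suc j) + negUnit 0 j) (Hᵇ 0))
      ≡⟨ det′-rows₀₁-+ n b (negUnit 1) (b ∘ suc) (negUnit 0) (Hᵇ 0) ⟩
    (det′ N (rows₀₁ b (b ∘ suc) (Hᵇ 0)) + det′ N (rows₀₁ b (negUnit 0) (Hᵇ 0)))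
      + (det′ N (rows₀₁ (negUnit 1) (b ∘ suc) (Hᵇ 0)) + det′ N (rows₀₁ (negUnit 1) (negUnit 0) (Hᵇ 0)))
      ≡⟨ cong₂ _+_ (cong₂ _+_ (trans (det′-cong N unperturbed) (det-Hᵇ-double N 0)) (det-even-rows₀₁ n))
                   (cong₂ _+_ (det-odd-rows₀₁ n) (det-negUnit-rows₀₁ n)) ⟩
    (h 0 ⌈ N /2⌉ * h 1 ⌊ N /2⌋ + 0ℤ) + (0ℤ + - h 4 n)          ≡⟨ simplify (h 0 ⌈ N /2⌉ * h 1 ⌊ N /2⌋) (h 4 n) ⟩
    h 0 ⌈ N /2⌉ * h 1 ⌊ N /2⌋ - h 4 n                          ∎
    where
    open ≡-Reasoning
    N = suc (suc n)
    split : H 0 ≐ rows₀₁ (λ j → b j + negUnit 1 j) (λ j → b (suc j) + negUnit 0 j) (Hᵇ 0)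
    split zero          zero          = sym (ℤ.+-identityʳ _)
    split zero          (suc zero)    = a₁
    split zero          (suc (suc j)) = sym (ℤ.+-identityʳ _)
    split (suc zero)    zero          = a₁
    split (suc zero)    (suc j)       = sym (ℤ.+-identityʳ _)
    split (suc (suc i)) j             = refl
    unperturbed : rows₀₁ b (b ∘ suc) (Hᵇ 0) ≐ Hᵇ 0
    unperturbed zero          j = refl
    unperturbed (suc zero)    j = refl
    unperturbed (suc (suc i)) j = refl
    simplify : ∀ x y → (x + 0ℤ) + (0ℤ + - y) ≡ x - y
    simplify = solve-∀

  h0-2+double : ∀ m → h 0 (suc (suc (double m))) ≡ h 0 (suc m) * h 1 (suc m) - h 2 m * h 3 m
  h0-2+double m = trans (h0-recurrence (double m))
    (cong₂ _-_ (cong₂ (λ u v → h 0 (suc u) * h 1 (suc v)) (⌈double/2⌉ m) (⌊double/2⌋ m))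
               (trans (h4-recurrence (double m)) (cong₂ (λ u v → h 2 u * h 3 v) (⌈double/2⌉ m) (⌊double/2⌋ m))))

  h0-3+double : ∀ m → h 0 (suc (suc (suc (double m)))) ≡ h 0 (suc (suc m)) * h 1 (suc m) - h 2 (suc m) * h 3 m
  h0-3+double m = trans (h0-recurrence (suc (double m)))
    (cong₂ _-_ (cong₂ (λ u v → h 0 (suc (suc u)) * h 1 (suc v)) (⌊double/2⌋ m) (⌊1+double/2⌋ m))
               (trans (h4-recurrence (suc (double m))) (cong₂ (λ u v → h 2 (suc u) * h 3 v) (⌊double/2⌋ m) (⌊1+double/2⌋ m))))

  h2-1+double : ∀ m → h 2 (suc (double m)) ≡ h 1 (suc m) * h 2 m
  h2-1+double m = trans (h2-recurrence (suc (double m)))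
                        (cong₂ (λ u v → h 1 (suc u) * h 2 v) (⌊double/2⌋ m) (⌊1+double/2⌋ m))

  h2-double : ∀ m → h 2 (double (suc m)) ≡ h 1 (suc m) * h 2 (suc m)
  h2-double m = trans (h2-recurrence (double (suc m)))
                      (cong₂ (λ u v → h 1 (suc u) * h 2 (suc v)) (⌈double/2⌉ m) (⌊double/2⌋ m))

  h1-h2-signs : ∀ n → IsSign (h 1 n) × IsSign (h 2 n)
  h1-h2-signs = <-rec _ step
    where
    h1-sign : ∀ n → (∀ {k} → k < n → IsSign (h 1 k) × IsSign (h 2 k)) → IsSign (h 1 n)
    h1-sign n ih with evenOdd n
    ... | even zero    = refl
    ... | even (suc m) = subst IsSign (sym (h1-double m))
                           (IsSign-*x*x (sgn (suc m)) _ (sgn*sgn≡1 (suc m)) (proj₁ (ih (s≤s (s≤s (m≤double m))))))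
    ... | odd m        = subst IsSign (sym (h1-1+double m))
                           (IsSign-*x*x (- sgn m) _ (sgn*sgn≡1 (suc m)) (proj₂ (ih (s≤s (m≤double m)))))
    step : ∀ n → (∀ {k} → k < n → IsSign (h 1 k) × IsSign (h 2 k)) → IsSign (h 1 n) × IsSign (h 2 n)
    step zero          ih = refl , refl
    step (suc zero)    ih = h1-sign 1 ih ,
      subst IsSign (sym (h2-recurrence 1)) (IsSign-* (h 1 1) (h 2 0) (h1-sign 1 ih) (proj₂ (ih (s≤s z≤n))))
    step (suc (suc n)) ih = h1-sign (suc (suc n)) ih ,
      subst IsSign (sym (h2-recurrence (suc (suc n))))
            (IsSign-* (h 1 ⌈ suc (suc n) /2⌉) (h 2 ⌊ suc (suc n) /2⌋)
                      (proj₁ (ih (ℕ.⌈n/2⌉<n n))) (proj₂ (ih (ℕ.⌊n/2⌋<n (suc n)))))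

  h2-sign : ∀ n → IsSign (h 2 n)
  h2-sign n = proj₂ (h1-h2-signs n)

  h1*evenBit : ∀ m → h 1 (suc m) * evenBit m ≡ - h 3 m
  h1*evenBit m with evenOdd m
  ... | even k = begin
    h 1 (suc (double k)) * evenBit (double k) ≡⟨ cong₂ _*_ (h1-1+double k) (cong (+_ ∘ bit) (evens-double k)) ⟩
    - sgn k * h 2 k * h 2 k * 1ℤ              ≡⟨ regroup (sgn k) (h 2 k) ⟩
    - (sgn k * h 2 k * h 2 k)                 ≡⟨ cong -_ (sym (h3-double k)) ⟩
    - h 3 (double k)                          ∎
    where
    open ≡-Reasoning
    regroup : ∀ s x → - s * x * x * 1ℤ ≡ - (s * x * x)
    regroup = solve-∀
  ... | odd k = begin
    h 1 (suc (suc (double k))) * evenBit (suc (double k)) ≡⟨ cong (λ b → h 1 (suc (suc (double k))) * + bit b) (evens-1+double k) ⟩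
    h 1 (suc (suc (double k))) * 0ℤ                       ≡⟨ ℤ.*-zeroʳ (h 1 (suc (suc (double k)))) ⟩
    0ℤ                                                    ≡⟨ cong -_ (sym (h3-1+double k)) ⟩
    - h 3 (suc (double k))                                ∎
    where open ≡-Reasoning

  h0-formula : (s : ℕ → ℤ) → s 0 ≡ 1ℤ → (∀ m → s (suc (double m)) ≡ s m + evenBit m) →
               (∀ m → s (double (suc m)) ≡ s (suc m) + evenBit m) → ∀ n → h 0 (suc n) ≡ h 2 n * s n
  h0-formula s s₀ s-odd s-even = <-rec _ step
    where
    assemble : ∀ k m → h 0 (suc k) ≡ h 2 k * s k →
               h 0 (suc k) * h 1 (suc m) - h 2 k * h 3 m ≡ h 1 (suc m) * h 2 k * (s k + evenBit m)
    assemble k m ih = begin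
      h 0 (suc k) * h 1 (suc m) - h 2 k * h 3 m                       ≡⟨ cong₂ (λ u v → u * h 1 (suc m) - h 2 k * v) ih h3≡ ⟩
      h 2 k * s k * h 1 (suc m) - h 2 k * - (h 1 (suc m) * evenBit m) ≡⟨ rearrange (h 2 k) (s k) (h 1 (suc m)) (evenBit m) ⟩
      h 1 (suc m) * h 2 k * (s k + evenBit m)                         ∎
      where
      open ≡-Reasoning
      rearrange : ∀ x t y e → x * t * y - x * - (y * e) ≡ y * x * (t + e)
      rearrange = solve-∀
      h3≡ : h 3 m ≡ - (h 1 (suc m) * evenBit m)
      h3≡ = trans (sym (ℤ.neg-involutive (h 3 m))) (cong -_ (sym (h1*evenBit m)))
    step : ∀ n → (∀ {k} → k < n → h 0 (suc k) ≡ h 2 k * s k) → h 0 (suc n) ≡ h 2 n * s n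
    step zero    ih = trans (cong (λ u → 1ℤ * u * 1ℤ + 0ℤ) a₀) (sym (cong (1ℤ *_) s₀))
    step (suc n) ih with evenOdd n
    ... | even m = trans (h0-2+double m) (trans (assemble m m (ih (s≤s (m≤double m))))
                     (sym (cong₂ _*_ (h2-1+double m) (s-odd m))))
    ... | odd  m = trans (h0-3+double m) (trans (assemble (suc m) m (ih (s≤s (s≤s (m≤double m)))))
                     (sym (cong₂ _*_ (h2-double m) (s-even m))))

n<2^n : ∀ n → n < 2 ^ n
n<2^n zero    = s≤s z≤n
n<2^n (suc n) = ℕ.+-mono-≤ (ℕ.≤-trans (s≤s z≤n) (n<2^n n)) (ℕ.≤-trans (n<2^n n) (ℕ.m≤m+n (2 ^ n) 0))

isPow2-sound : ∀ m → isPow2 m ≡ true → ∃[ k ] 2 ^ k ≡ m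
isPow2-sound m isPow2≡true with satisfied (any⁻ _ (upTo (suc m)) (Equivalence.from T-≡ isPow2≡true))
... | k , 2^k≟m = k , toWitness 2^k≟m

isPow2-complete : ∀ m k → 2 ^ k ≡ m → isPow2 m ≡ true
isPow2-complete m k 2^k≡m = Equivalence.to T-≡ (any⁺ _ (lose (∈-upTo⁺ (s≤s k≤m)) (fromWitness 2^k≡m)))
  where
  k≤m : k ≤ m
  k≤m = subst (k ≤_) 2^k≡m (ℕ.<⇒≤ (n<2^n k))

≡true-ext : ∀ {x y} → (x ≡ true → y ≡ true) → (y ≡ true → x ≡ true) → x ≡ y
≡true-ext {true}          x⇒y y⇒x = sym (x⇒y refl)
≡true-ext {false} {true}  x⇒y y⇒x = y⇒x refl
≡true-ext {false} {false} x⇒y y⇒x = refl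

double≡2* : ∀ x → double x ≡ 2 ℕ.* x
double≡2* zero    = refl
double≡2* (suc x) = cong suc (trans (cong suc (double≡2* x)) (sym (ℕ.+-suc x (x ℕ.+ 0))))

double-injective : ∀ x y → double x ≡ double y → x ≡ y
double-injective zero    zero    eq = refl
double-injective (suc x) (suc y) eq = cong suc (double-injective x y (ℕ.suc-injective (ℕ.suc-injective eq)))

double≢1+double : ∀ x y → ¬ double x ≡ suc (double y)
double≢1+double (suc x) (suc y) eq = double≢1+double x y (ℕ.suc-injective (ℕ.suc-injective eq))

isPow2-double : ∀ m → isPow2 (double (suc m)) ≡ isPow2 (suc m)
isPow2-double m = ≡true-ext halve twice
  where
  halve : isPow2 (double (suc m)) ≡ true → isPow2 (suc m) ≡ true
  halve isPow2≡true with isPow2-sound (double (suc m)) isPow2≡true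
  ... | suc k , 2^k+1≡ = isPow2-complete (suc m) k (double-injective _ _ (trans (double≡2* (2 ^ k)) 2^k+1≡))
  twice : isPow2 (suc m) ≡ true → isPow2 (double (suc m)) ≡ true
  twice isPow2≡true with isPow2-sound (suc m) isPow2≡true
  ... | k , 2^k≡ = isPow2-complete (double (suc m)) (suc k) (trans (sym (double≡2* (2 ^ k))) (cong double 2^k≡))

isPow2-1+double : ∀ m → isPow2 (suc (double (suc m))) ≡ false
isPow2-1+double m with isPow2 (suc (double (suc m))) in isPow2≡
... | false = refl
... | true with isPow2-sound (suc (double (suc m))) isPow2≡
...   | suc k , 2^k+1≡ = ⊥-elim (double≢1+double (2 ^ k) (suc m) (trans (double≡2* (2 ^ k)) 2^k+1≡))

Bcoeff-double : ∀ m → Bcoeff (double (suc m)) ≡ Bcoeff (suc m)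
Bcoeff-double m = cong (λ b → if b then -1ℤ else 0ℤ) (isPow2-double m)

Bcoeff-1+double : ∀ m → Bcoeff (suc (double (suc m))) ≡ 0ℤ
Bcoeff-1+double m = cong (λ b → if b then -1ℤ else 0ℤ) (isPow2-1+double m)

private
  [2+n]%2≡n%2 : ∀ n → suc (suc n) % 2 ≡ n % 2
  [2+n]%2≡n%2 n = trans (cong (_% 2) (ℕ.+-comm 2 n)) (ℕ.[m+kn]%n≡m%n n 1 2)

  [2+n]/2≡1+n/2 : ∀ n → suc (suc n) / 2 ≡ suc (n / 2)
  [2+n]/2≡1+n/2 n = ℕ.m/n≡1+[m∸n]/n {suc (suc n)} {2} (s≤s (s≤s z≤n))

  double%2 : ∀ k → double k % 2 ≡ 0
  double%2 zero    = refl
  double%2 (suc k) = trans ([2+n]%2≡n%2 (double k)) (double%2 k)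

  [1+double]%2 : ∀ k → suc (double k) % 2 ≡ 1
  [1+double]%2 zero    = refl
  [1+double]%2 (suc k) = trans ([2+n]%2≡n%2 (suc (double k))) ([1+double]%2 k)

  double/2 : ∀ k → double k / 2 ≡ k
  double/2 zero    = refl
  double/2 (suc k) = trans ([2+n]/2≡1+n/2 (double k)) (cong suc (double/2 k))

  [1+double]/2 : ∀ k → suc (double k) / 2 ≡ k
  [1+double]/2 zero    = refl
  [1+double]/2 (suc k) = trans ([2+n]/2≡1+n/2 (suc (double k))) (cong suc ([1+double]/2 k))

jStep : ℕ → ℕ → ℕ → ℤ
jStep f m zero    = jFuel f (suc m / 2)
jStep f m (suc _) = sgn (suc m / 2)

jFuel-suc : ∀ f m → jFuel (suc f) (suc m) ≡ jStep f m (suc m % 2)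
jFuel-suc f m with suc m % 2
... | zero  = refl
... | suc _ = refl

jFuel-irrelevant : ∀ f g n → n < f → n < g → jFuel f n ≡ jFuel g n
jFuel-irrelevant (suc f) (suc g) zero    _         _         = refl
jFuel-irrelevant (suc f) (suc g) (suc m) (s≤s m<f) (s≤s m<g) =
  trans (jFuel-suc f m) (trans (same-step (suc m % 2)) (sym (jFuel-suc g m)))
  where
  half< : ∀ {b} → suc m ≤ b → suc m / 2 < b
  half< = ℕ.<-≤-trans (ℕ.m/n<m (suc m) 2 (s≤s (s≤s z≤n)))
  same-step : ∀ r → jStep f m r ≡ jStep g m r
  same-step zero    = jFuel-irrelevant f g (suc m / 2) (half< m<f) (half< m<g)
  same-step (suc r) = refl

jseq-double : ∀ k → jseq (double (suc k)) ≡ jseq (suc k)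
jseq-double k = begin
  jFuel (suc (suc (suc (double k)))) (suc (suc (double k)))     ≡⟨ jFuel-suc (suc (suc (double k))) (suc (double k)) ⟩
  jStep (suc (suc (double k))) (suc (double k)) (double (suc k) % 2) ≡⟨ cong (jStep _ (suc (double k))) (double%2 (suc k)) ⟩
  jFuel (suc (suc (double k))) (double (suc k) / 2)             ≡⟨ cong (jFuel (suc (suc (double k)))) (double/2 (suc k)) ⟩
  jFuel (suc (suc (double k))) (suc k)
    ≡⟨ jFuel-irrelevant _ _ (suc k) (s≤s (s≤s (m≤double k))) (s≤s (s≤s ℕ.≤-refl)) ⟩
  jseq (suc k)                                                  ∎
  where open ≡-Reasoning

jseq-1+double : ∀ k → jseq (suc (double k)) ≡ sgn k
jseq-1+double k = trans (jFuel-suc (suc (double k)) (double k))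
  (trans (cong (jStep (suc (double k)) (double k)) ([1+double]%2 k)) (cong sgn ([1+double]/2 k)))

sseq-suc : ∀ n → sseq (suc n) ≡ sseq n + jseq (suc n)
sseq-suc n = begin
  1ℤ + ∑ (suc (suc n)) (jseq ∘ toℕ)   ≡⟨ cong (_+_ 1ℤ) (∑≡sum (suc (suc n)) (jseq ∘ toℕ) jseq (λ _ → refl)) ⟩
  1ℤ + sum (suc (suc n)) jseq          ≡⟨ cong (_+_ 1ℤ) (sum-snoc (suc n) jseq) ⟩
  1ℤ + (sum (suc n) jseq + jseq (suc n)) ≡⟨ ℤ.+-assoc 1ℤ (sum (suc n) jseq) (jseq (suc n)) ⟨
  1ℤ + sum (suc n) jseq + jseq (suc n)
    ≡⟨ cong (λ x → 1ℤ + x + jseq (suc n)) (∑≡sum (suc n) (jseq ∘ toℕ) jseq (λ _ → refl)) ⟨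
  sseq n + jseq (suc n)               ∎
  where open ≡-Reasoning

sseq-1+double : ∀ m → sseq (suc (double m)) ≡ sseq m + evenBit m
sseq-double   : ∀ m → sseq (double (suc m)) ≡ sseq (suc m) + evenBit m

sseq-1+double zero    = refl
sseq-1+double (suc m) = begin
  sseq (suc (double (suc m)))                            ≡⟨ sseq-suc (double (suc m)) ⟩
  sseq (double (suc m)) + jseq (suc (double (suc m)))    ≡⟨ cong₂ _+_ (sseq-double m) (jseq-1+double (suc m)) ⟩
  sseq (suc m) + evenBit m + sgn (suc m)                 ≡⟨ ℤ.+-assoc (sseq (suc m)) (evenBit m) (sgn (suc m)) ⟩
  sseq (suc m) + (evenBit m + sgn (suc m))               ≡⟨ cong (_+_ (sseq (suc m))) (evenBit+sgn m) ⟩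
  sseq (suc m) + evenBit (suc m)                         ∎
  where open ≡-Reasoning

sseq-double m = begin
  sseq (suc (suc (double m)))                            ≡⟨ sseq-suc (suc (double m)) ⟩
  sseq (suc (double m)) + jseq (double (suc m))          ≡⟨ cong₂ _+_ (sseq-1+double m) (jseq-double m) ⟩
  sseq m + evenBit m + jseq (suc m)                      ≡⟨ ℤ.+-assoc (sseq m) (evenBit m) (jseq (suc m)) ⟩
  sseq m + (evenBit m + jseq (suc m))                    ≡⟨ cong (_+_ (sseq m)) (ℤ.+-comm (evenBit m) (jseq (suc m))) ⟩
  sseq m + (jseq (suc m) + evenBit m)                    ≡⟨ ℤ.+-assoc (sseq m) (jseq (suc m)) (evenBit m) ⟨
  sseq m + jseq (suc m) + evenBit m                      ≡⟨ cong (_+ evenBit m) (sseq-suc m) ⟨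
  sseq (suc m) + evenBit m                               ∎
  where open ≡-Reasoning

sseq-nonneg : ∀ n → 0ℤ ≤ℤ sseq n
sseq-nonneg = <-rec _ step
  where
  step : ∀ n → (∀ {k} → k < n → 0ℤ ≤ℤ sseq k) → 0ℤ ≤ℤ sseq n
  step n ih with evenOdd n
  ... | even zero    = +≤+ z≤n
  ... | even (suc m) = subst (0ℤ ≤ℤ_) (sym (sseq-double m))
                         (ℤ.+-mono-≤ (ih (s≤s (s≤s (m≤double m)))) (+≤+ z≤n))
  ... | odd m        = subst (0ℤ ≤ℤ_) (sym (sseq-1+double m)) (ℤ.+-mono-≤ (ih (s≤s (m≤double m))) (+≤+ z≤n))

open HankelRecurrences Bcoeff refl refl Bcoeff-double Bcoeff-1+double

theorem22 : (n : ℕ) → + ∣ hankel Bcoeff (suc n) ∣ ≡ sseq n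
theorem22 n = begin
  + ∣ hankel Bcoeff (suc n) ∣ ≡⟨ cong (+_ ∘ ∣_∣) (det≡det′ (suc n) (H 0)) ⟩
  + ∣ h 0 (suc n) ∣           ≡⟨ cong (+_ ∘ ∣_∣) (h0-formula sseq refl sseq-1+double sseq-double n) ⟩
  + ∣ h 2 n * sseq n ∣        ≡⟨ cong +_ (∣sign*x∣≡∣x∣ (h 2 n) (sseq n) (h2-sign n)) ⟩
  + ∣ sseq n ∣                ≡⟨ ℤ.0≤i⇒+∣i∣≡i (sseq-nonneg n) ⟩
  sseq n                      ∎
  where open ≡-Reasoning
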